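{- There exists a $(108,4,1)$-PLDF.
   Context: Let $k\geq 2$, $v$ an even positive integer, and $\mathbb{Q}[\mathbb{Z}_v]$ the group ring of $\mathbb{Z}_v$ over the rationals (formal sums $\sum_{g\in\mathbb{Z}_v}a_g g$, $a_g\in\mathbb{Q}$, added coefficientwise). Elements of $\mathbb{Z}_v$ are identified with representatives in $\{0,\dots,v-1\}$. For an ordered $k$-tuple $B=(b_0,\dots,b_{k-1})$ of (not necessarily distinct) elements of $\mathbb{Z}_v$ and $0\leq s_1<s_2<k$, define $\Delta^{*+}(b_{s_1},b_{s_2})=\sum_{0\leq\ell<s_2-s_1}\frac{1}{s_2-s_1}(b_{s_2}-b_{s_1}+\ell)$ if $b_{s_1}\leq b_{s_2}$ (as representatives), and $\Delta^{*+}(b_{s_1},b_{s_2})=\sum_{0\leq\ell<s_2-s_1}\frac{1}{s_2-s_1}(b_{s_1}-b_{s_2}-\ell-1)$ if $b_{s_1}>b_{s_2}$; here the terms in parentheses are group elements of $\mathbb{Z}_v$ and $\frac{1}{s_2-s_1}\in\mathbb{Q}$ are coefficients. Let $\Delta^{*+}B=\sum_{0\leq s_1<s_2<k}\Delta^{*+}(b_{s_1},b_{s_2})$. A collection $\mathcal B$ of such ordered $k$-tuples is a perfect $(v,k,\lambda)$-layered difference family (PLDF) if $\sum_{B\in\mathcal B}\Delta^{*+}B=\lambda\sum_{g=0}^{v/2-1}g$ in $\mathbb{Q}[\mathbb{Z}_v]$. -}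

module Defs where

open import Data.Nat as ℕ using (ℕ; zero; suc; NonZero; _∸_; _<ᵇ_)
open import Data.Nat.DivMod using (_mod_; _/_)
open import Data.Integer as ℤ using (ℤ; +_)
open import Data.Integer.DivMod using (_%ℕ_)
open import Data.Fin as Fin using (Fin; toℕ)
open import Data.Fin.Properties using () renaming (_≟_ to _≟ᶠ_)
open import Data.Vec as Vec using (Vec; lookup)
open import Data.List as List using (List; []; _∷_; upTo; allFin; map; foldr; concatMap)
open import Data.Rational as ℚ using (ℚ; 0ℚ; 1ℚ)
open import Data.Bool using (if_then_else_)
open import Relation.Nullary using (does)
open import Relation.Binary.PropositionalEquality using (_≡_)

-- The group ring ℚ[ℤ_v]: an element is its coefficient function Fin v → ℚ
-- (elements of ℤ_v are the representatives 0 … v-1, i.e. Fin v).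
GR : ℕ → Set
GR v = Fin v → ℚ

module _ {v : ℕ} where
  0GR : GR v
  0GR _ = 0ℚ

  _⊕_ : GR v → GR v → GR v
  (x ⊕ y) g = x g ℚ.+ y g

  _⊙_ : ℚ → GR v → GR v
  (q ⊙ x) g = q ℚ.* x g

  ⟦_⟧ : Fin v → GR v
  ⟦ h ⟧ g = if does (h ≟ᶠ g) then 1ℚ else 0ℚ

  ΣGR : List (GR v) → GR v
  ΣGR = foldr _⊕_ 0GR

  _≈GR_ : GR v → GR v → Set
  x ≈GR y = ∀ g → x g ≡ y g

toZ : (v : ℕ) .{{_ : NonZero v}} → ℤ → Fin v
toZ v i = (i %ℕ v) mod v

-- the rational 1/d (only used for d ≥ 1)
inv : ℕ → ℚ
inv zero    = 0ℚ
inv (suc n) = + 1 ℚ./ suc n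

Δpair : (v : ℕ) .{{_ : NonZero v}} → (d : ℕ) → Fin v → Fin v → GR v
Δpair v d b₁ b₂ =
  if toℕ b₂ <ᵇ toℕ b₁
  then ΣGR (map (λ ℓ → inv d ⊙ ⟦ toZ v (ℤ.+ toℕ b₁ ℤ.- ℤ.+ toℕ b₂ ℤ.- ℤ.+ ℓ ℤ.- ℤ.+ 1) ⟧) (upTo d))
  else ΣGR (map (λ ℓ → inv d ⊙ ⟦ toZ v (ℤ.+ toℕ b₂ ℤ.- ℤ.+ toℕ b₁ ℤ.+ ℤ.+ ℓ) ⟧) (upTo d))

Δ*+ : (v : ℕ) .{{_ : NonZero v}} → {k : ℕ} → Vec (Fin v) k → GR v
Δ*+ v {k} B =
  ΣGR (concatMap (λ s₁ → concatMap (λ s₂ →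
         if toℕ s₁ <ᵇ toℕ s₂
         then Δpair v (toℕ s₂ ∸ toℕ s₁) (lookup B s₁) (lookup B s₂) ∷ []
         else []) (allFin k)) (allFin k))

-- Perfect (v,k,λ)-layered difference family: a collection (list, repetitions
-- allowed) of ordered k-tuples with Σ_B Δ*+ B = λ Σ_{g=0}^{v/2-1} g.
IsPLDF : (v k λ' : ℕ) .{{_ : NonZero v}} → List (Vec (Fin v) k) → Set
IsPLDF v k λ' ℬ =
  ΣGR (map (Δ*+ v) ℬ) ≈GR (((ℤ.+ λ') ℚ./ 1) ⊙ ΣGR (map (λ g → ⟦ g mod v ⟧) (upTo (v / 2))))

{-# OPTIONS --safe #-}
module Submission where

open import Defs
open import Data.Nat using (NonZero)
open import Data.Fin using (Fin; #_)
open import Data.Fin.Properties using (all?)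
open import Data.Vec using (Vec; _∷_; [])
open import Data.List using (List; _∷_; [])
open import Data.Product using (∃; _,_)
open import Data.Rational.Properties using (_≟_)
open import Relation.Nullary using (Dec)
open import Relation.Nullary.Decidable using (toWitness)

_≈GR?_ : ∀ {v} (x y : GR v) → Dec (x ≈GR y)
x ≈GR? y = all? (λ g → x g ≟ y g)

isPLDF? : ∀ v k λ' .{{_ : NonZero v}} (ℬ : List (Vec (Fin v) k)) → Dec (IsPLDF v k λ' ℬ)
isPLDF? v k λ' ℬ = _ ≈GR? _

pldf-108-4-1 : List (Vec (Fin 108) 4)
pldf-108-4-1 =
    (# 0 ∷ # 12 ∷ # 52 ∷ # 0 ∷ [])
  ∷ (# 0 ∷ # 33 ∷ # 52 ∷ # 7 ∷ [])
  ∷ (# 0 ∷ # 39 ∷ # 10 ∷ # 3 ∷ [])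
  ∷ (# 0 ∷ # 50 ∷ # 34 ∷ # 7 ∷ [])
  ∷ (# 0 ∷ # 46 ∷ # 31 ∷ # 3 ∷ [])
  ∷ (# 0 ∷ # 29 ∷ # 47 ∷ # 3 ∷ [])
  ∷ (# 0 ∷ # 49 ∷ # 31 ∷ # 0 ∷ [])
  ∷ (# 0 ∷ # 38 ∷ # 21 ∷ # 0 ∷ [])
  ∷ (# 0 ∷ # 45 ∷ # 21 ∷ # 7 ∷ [])
  ∷ []

lemma3p8 : ∃ λ (ℬ : List (Vec (Fin 108) 4)) → IsPLDF 108 4 1 ℬ
lemma3p8 = pldf-108-4-1 , toWitness {a? = isPLDF? 108 4 1 pldf-108-4-1} _
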